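{- Let $\mathsf L$ be a system of linear equations with integer coefficients, and let $p,q\in\mathbb Z$ be coprime. If $\mathsf L$ has a $p$-solution and a $q$-solution, then it has an integral solution.
   Context: For an integer $p$, a $p$-solution of a system of linear equations is a solution over $\mathbb Q$ all of whose values lie in $\{0\}\cup\{p^z: z\in\mathbb Z\}$. -}

module Defs where

open import Data.Nat using (ℕ)
open import Data.Fin using (Fin)
open import Data.Integer as ℤ using (ℤ)
open import Data.Rational as ℚ using (ℚ; _/_)
open import Data.Product using (∃; _×_)
open import Data.Sum using (_⊎_)
open import Relation.Binary.PropositionalEquality using (_≡_)

Σℚ : (n : ℕ) → (Fin n → ℚ) → ℚ
Σℚ ℕ.zero f = ℚ.0ℚ
Σℚ (ℕ.suc n) f = f Fin.zero ℚ.+ Σℚ n (λ i → f (Fin.suc i))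
  where import Data.Fin as Fin

record LinSys (m n : ℕ) : Set where
  constructor linSys
  field
    coef : Fin m → Fin n → ℤ
    rhs  : Fin m → ℤ
open LinSys public

IsSolution : ∀ {m n} → LinSys m n → (Fin n → ℚ) → Set
IsSolution {m} {n} L x =
  (i : Fin m) → Σℚ n (λ j → (coef L i j / 1) ℚ.* x j) ≡ rhs L i / 1

-- x ∈ {p^z : z ∈ ℤ} : either x = p^k or x = p^(-k), i.e. p^k * x = 1, for some k : ℕ
IsIntPower : ℤ → ℚ → Set
IsIntPower p x = ∃ λ (k : ℕ) → (x ≡ (p ℤ.^ k) / 1) ⊎ (((p ℤ.^ k) / 1) ℚ.* x ≡ ℚ.1ℚ)

IsPSolution : ∀ {m n} → ℤ → LinSys m n → (Fin n → ℚ) → Set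
IsPSolution p L x = IsSolution L x × ((j : _) → (x j ≡ ℚ.0ℚ) ⊎ IsIntPower p (x j))

IsIntSolution : ∀ {m n} → LinSys m n → (Fin n → ℤ) → Set
IsIntSolution L x = IsSolution L (λ j → x j / 1)

-- Every entry of a p-solution x is 0 or an integer power p^z, so multiplying x
-- by a large enough power p^a turns it into an integer vector u; then u solves
-- the system with right-hand side scaled by p^a.  Likewise some v solves it with
-- right-hand side scaled by q^b.  Since p and q are coprime so are p^a and q^b,
-- hence s·p^a + t·q^b = 1 for some integers s, t, and by linearity s·u + t·v
-- solves the system with right-hand side scaled by 1, i.e. the original one.
module Submission where

open import Defs
open import Data.Nat using (ℕ)
open import Data.Fin using (Fin)
open import Data.Integer using (ℤ; ∣_∣)
open import Data.Nat.Coprimality using (Coprime)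
open import Data.Product using (∃)

import Data.Nat as ℕ
import Data.Nat.Properties as ℕP
import Data.Nat.GCD as NG
import Data.Nat.Coprimality as NC
import Data.Fin as F
open import Data.Integer as ℤ using (+_)
import Data.Integer.Properties as ℤP
open import Data.Integer.Tactic.RingSolver using () renaming (solve-∀ to solveℤ)
open import Data.Rational as ℚ using (ℚ; _/_)
import Data.Rational.Properties as ℚP
open import Data.Rational.Solver using (module +-*-Solver)
import Data.Rational.Unnormalised as ℚᵘ
import Data.Rational.Unnormalised.Properties as ℚᵘP
open import Data.Product using (Σ; _,_; proj₁; proj₂)
open import Data.Sum using (_⊎_; inj₁; inj₂)
open import Relation.Binary.PropositionalEquality

ι : ℤ → ℚ
ι i = i / 1

ι-unnormalised : ∀ i → ℚ.toℚᵘ (ι i) ℚᵘ.≃ ℚᵘ.mkℚᵘ i 0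
ι-unnormalised i = ℚP.toℚᵘ-fromℚᵘ (ℚᵘ.mkℚᵘ i 0)

-- ι is multiplicative (i/1 · j/1 is (i·j)/1 on the nose in ℚᵘ).
ι-* : ∀ i j → ι (i ℤ.* j) ≡ ι i ℚ.* ι j
ι-* i j = ℚP.toℚᵘ-injective (begin
    ℚ.toℚᵘ (ι (i ℤ.* j))                   ≈⟨ ι-unnormalised (i ℤ.* j) ⟩
    ℚᵘ.mkℚᵘ i 0 ℚᵘ.* ℚᵘ.mkℚᵘ j 0           ≈⟨ ℚᵘP.*-cong (ι-unnormalised i) (ι-unnormalised j) ⟨
    ℚ.toℚᵘ (ι i) ℚᵘ.* ℚ.toℚᵘ (ι j)         ≈⟨ ℚP.toℚᵘ-homo-* (ι i) (ι j) ⟨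
    ℚ.toℚᵘ (ι i ℚ.* ι j)                   ∎)
  where open ℚᵘP.≃-Reasoning

ι-+ : ∀ i j → ι (i ℤ.+ j) ≡ ι i ℚ.+ ι j
ι-+ i j = ℚP.toℚᵘ-injective (begin
    ℚ.toℚᵘ (ι (i ℤ.+ j))                   ≈⟨ ι-unnormalised (i ℤ.+ j) ⟩
    ℚᵘ.mkℚᵘ (i ℤ.+ j) 0                    ≈⟨ ℚᵘ.*≡* (sumOverOne i j) ⟩
    ℚᵘ.mkℚᵘ i 0 ℚᵘ.+ ℚᵘ.mkℚᵘ j 0           ≈⟨ ℚᵘP.+-cong (ι-unnormalised i) (ι-unnormalised j) ⟨
    ℚ.toℚᵘ (ι i) ℚᵘ.+ ℚ.toℚᵘ (ι j)         ≈⟨ ℚP.toℚᵘ-homo-+ (ι i) (ι j) ⟨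
    ℚ.toℚᵘ (ι i ℚ.+ ι j)                   ∎)
  where
  open ℚᵘP.≃-Reasoning
  -- in ℚᵘ, i/1 + j/1 is (i·1 + j·1)/(1·1); cross-multiplying gives this identity
  sumOverOne : ∀ i j → (i ℤ.+ j) ℤ.* + 1 ≡ (i ℤ.* + 1 ℤ.+ j ℤ.* + 1) ℤ.* + 1
  sumOverOne = solveℤ

dot : ∀ {n} → (Fin n → ℚ) → (Fin n → ℚ) → ℚ
dot {n} A x = Σℚ n (λ j → A j ℚ.* x j)

row : ∀ {m n} → LinSys m n → Fin m → Fin n → ℚ
row L i j = coef L i j / 1

dot-cong : ∀ {n} (A : Fin n → ℚ) {x y : Fin n → ℚ} → (∀ j → x j ≡ y j) → dot A x ≡ dot A y
dot-cong {ℕ.zero} A e = refl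
dot-cong {ℕ.suc n} A e =
  cong₂ ℚ._+_ (cong (A F.zero ℚ.*_) (e F.zero)) (dot-cong (λ j → A (F.suc j)) (λ j → e (F.suc j)))

dot-linear : ∀ {n} (A x y : Fin n → ℚ) (a b : ℚ) →
  dot A (λ j → a ℚ.* x j ℚ.+ b ℚ.* y j) ≡ a ℚ.* dot A x ℚ.+ b ℚ.* dot A y
dot-linear {ℕ.zero} A x y a b =
  sym (trans (cong₂ ℚ._+_ (ℚP.*-zeroʳ a) (ℚP.*-zeroʳ b)) (ℚP.+-identityʳ ℚ.0ℚ))
dot-linear {ℕ.suc n} A x y a b = begin
    A₀ ℚ.* (a ℚ.* x₀ ℚ.+ b ℚ.* y₀) ℚ.+ dot A′ (λ j → a ℚ.* x′ j ℚ.+ b ℚ.* y′ j)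
  ≡⟨ cong (A₀ ℚ.* (a ℚ.* x₀ ℚ.+ b ℚ.* y₀) ℚ.+_) (dot-linear A′ x′ y′ a b) ⟩
    A₀ ℚ.* (a ℚ.* x₀ ℚ.+ b ℚ.* y₀) ℚ.+ (a ℚ.* dot A′ x′ ℚ.+ b ℚ.* dot A′ y′)
  ≡⟨ regroup A₀ a x₀ b y₀ (dot A′ x′) (dot A′ y′) ⟩
    a ℚ.* (A₀ ℚ.* x₀ ℚ.+ dot A′ x′) ℚ.+ b ℚ.* (A₀ ℚ.* y₀ ℚ.+ dot A′ y′)
  ∎
  where
  open ≡-Reasoning
  A₀ = A F.zero
  x₀ = x F.zero
  y₀ = y F.zero
  A′ x′ y′ : Fin n → ℚ
  A′ j = A (F.suc j)
  x′ j = x (F.suc j)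
  y′ j = y (F.suc j)
  regroup : ∀ A₀ a x₀ b y₀ X Y →
    A₀ ℚ.* (a ℚ.* x₀ ℚ.+ b ℚ.* y₀) ℚ.+ (a ℚ.* X ℚ.+ b ℚ.* Y)
      ≡ a ℚ.* (A₀ ℚ.* x₀ ℚ.+ X) ℚ.+ b ℚ.* (A₀ ℚ.* y₀ ℚ.+ Y)
  regroup = solve 7 (λ A₀ a x₀ b y₀ X Y →
    A₀ :* (a :* x₀ :+ b :* y₀) :+ (a :* X :+ b :* Y)
      := a :* (A₀ :* x₀ :+ X) :+ b :* (A₀ :* y₀ :+ Y)) refl
    where open +-*-Solver

dot-scale : ∀ {n} (A x : Fin n → ℚ) (c : ℚ) → dot A (λ j → c ℚ.* x j) ≡ c ℚ.* dot A x
dot-scale A x c = begin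
    dot A (λ j → c ℚ.* x j)                   ≡⟨ dot-cong A (λ j → sym (plusZeroTimes c (x j))) ⟩
    dot A (λ j → c ℚ.* x j ℚ.+ ℚ.0ℚ ℚ.* x j)  ≡⟨ dot-linear A x x c ℚ.0ℚ ⟩
    c ℚ.* dot A x ℚ.+ ℚ.0ℚ ℚ.* dot A x        ≡⟨ plusZeroTimes c (dot A x) ⟩
    c ℚ.* dot A x                             ∎
  where
  open ≡-Reasoning
  plusZeroTimes : ∀ c y → c ℚ.* y ℚ.+ ℚ.0ℚ ℚ.* y ≡ c ℚ.* y
  plusZeroTimes c y = trans (cong (c ℚ.* y ℚ.+_) (ℚP.*-zeroˡ y)) (ℚP.+-identityʳ (c ℚ.* y))

ScaledSolution : ∀ {m n} → LinSys m n → ℤ → (Fin n → ℤ) → Set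
ScaledSolution {m} L c u = (i : Fin m) → dot (row L i) (λ j → ι (u j)) ≡ ι (c ℤ.* rhs L i)

scaled-combination : ∀ {m n} (L : LinSys m n) {P Q : ℤ} {u v : Fin n → ℤ} (s t : ℤ) →
  ScaledSolution L P u → ScaledSolution L Q v →
  ScaledSolution L (s ℤ.* P ℤ.+ t ℤ.* Q) (λ j → s ℤ.* u j ℤ.+ t ℤ.* v j)
scaled-combination L {P} {Q} {u} {v} s t hu hv i = begin
    dot A (λ j → ι (s ℤ.* u j ℤ.+ t ℤ.* v j))
  ≡⟨ dot-cong A (λ j → ι-combination s (u j) t (v j)) ⟩
    dot A (λ j → ι s ℚ.* ι (u j) ℚ.+ ι t ℚ.* ι (v j))
  ≡⟨ dot-linear A (λ j → ι (u j)) (λ j → ι (v j)) (ι s) (ι t) ⟩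
    ι s ℚ.* dot A (λ j → ι (u j)) ℚ.+ ι t ℚ.* dot A (λ j → ι (v j))
  ≡⟨ cong₂ (λ U V → ι s ℚ.* U ℚ.+ ι t ℚ.* V) (hu i) (hv i) ⟩
    ι s ℚ.* ι (P ℤ.* b) ℚ.+ ι t ℚ.* ι (Q ℤ.* b)
  ≡⟨ ι-combination s (P ℤ.* b) t (Q ℤ.* b) ⟨
    ι (s ℤ.* (P ℤ.* b) ℤ.+ t ℤ.* (Q ℤ.* b))
  ≡⟨ cong ι (factorRhs s P t Q b) ⟩
    ι ((s ℤ.* P ℤ.+ t ℤ.* Q) ℤ.* b)
  ∎
  where
  open ≡-Reasoning
  A = row L i
  b = rhs L i
  ι-combination : ∀ s x t y → ι (s ℤ.* x ℤ.+ t ℤ.* y) ≡ ι s ℚ.* ι x ℚ.+ ι t ℚ.* ι y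
  ι-combination s x t y = trans (ι-+ (s ℤ.* x) (t ℤ.* y)) (cong₂ ℚ._+_ (ι-* s x) (ι-* t y))
  factorRhs : ∀ s P t Q b → s ℤ.* (P ℤ.* b) ℤ.+ t ℤ.* (Q ℤ.* b) ≡ (s ℤ.* P ℤ.+ t ℤ.* Q) ℤ.* b
  factorRhs = solveℤ

unscaled : ∀ {m n} (L : LinSys m n) {z : Fin n → ℤ} → ScaledSolution L (+ 1) z → IsIntSolution L z
unscaled L hz i = trans (hz i) (cong ι (ℤP.*-identityˡ (rhs L i)))

clearEntry : ∀ (p : ℤ) {x : ℚ} → (x ≡ ℚ.0ℚ) ⊎ IsIntPower p x →
  Σ ℕ λ k → ∀ a → k ℕ.≤ a → Σ ℤ λ u → ι u ≡ ι (p ℤ.^ a) ℚ.* x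
clearEntry p (inj₁ refl) = 0 , λ a _ → + 0 , sym (ℚP.*-zeroʳ (ι (p ℤ.^ a)))
clearEntry p (inj₂ (k , inj₁ refl)) = 0 , λ a _ → p ℤ.^ a ℤ.* p ℤ.^ k , ι-* (p ℤ.^ a) (p ℤ.^ k)
clearEntry p {x} (inj₂ (k , inj₂ pᵏx≡1)) = k , λ a k≤a → p ℤ.^ (a ℕ.∸ k) , (begin
    ι (p ℤ.^ (a ℕ.∸ k))                              ≡⟨ ℚP.*-identityʳ _ ⟨
    ι (p ℤ.^ (a ℕ.∸ k)) ℚ.* ℚ.1ℚ                     ≡⟨ cong (ι (p ℤ.^ (a ℕ.∸ k)) ℚ.*_) pᵏx≡1 ⟨
    ι (p ℤ.^ (a ℕ.∸ k)) ℚ.* (ι (p ℤ.^ k) ℚ.* x)      ≡⟨ ℚP.*-assoc (ι (p ℤ.^ (a ℕ.∸ k))) (ι (p ℤ.^ k)) x ⟨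
    ι (p ℤ.^ (a ℕ.∸ k)) ℚ.* ι (p ℤ.^ k) ℚ.* x        ≡⟨ cong (ℚ._* x) (ι-* (p ℤ.^ (a ℕ.∸ k)) (p ℤ.^ k)) ⟨
    ι (p ℤ.^ (a ℕ.∸ k) ℤ.* p ℤ.^ k) ℚ.* x            ≡⟨ cong (λ e → ι e ℚ.* x) (ℤP.^-distribˡ-+-* p (a ℕ.∸ k) k) ⟨
    ι (p ℤ.^ (a ℕ.∸ k ℕ.+ k)) ℚ.* x                  ≡⟨ cong (λ e → ι (p ℤ.^ e) ℚ.* x) (ℕP.m∸n+n≡m k≤a) ⟩
    ι (p ℤ.^ a) ℚ.* x                                ∎)
  where open ≡-Reasoning

upperBound : ∀ n (f : Fin n → ℕ) → Σ ℕ λ a → ∀ j → f j ℕ.≤ a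
upperBound ℕ.zero f = 0 , λ ()
upperBound (ℕ.suc n) f with upperBound n (λ j → f (F.suc j))
... | a , bounded = f F.zero ℕ.⊔ a , λ where
  F.zero    → ℕP.m≤m⊔n (f F.zero) a
  (F.suc j) → ℕP.≤-trans (bounded j) (ℕP.m≤n⊔m (f F.zero) a)

clearDenominators : ∀ {m n} (L : LinSys m n) (p : ℤ) {x : Fin n → ℚ} →
  IsPSolution p L x → Σ ℕ λ a → Σ (Fin n → ℤ) λ u → ScaledSolution L (p ℤ.^ a) u
clearDenominators {n = n} L p {x} (solves , entries) = a , u , scaled
  where
  threshold : Fin n → ℕ
  threshold j = proj₁ (clearEntry p (entries j))
  a = proj₁ (upperBound n threshold)
  cleared : ∀ j → Σ ℤ λ uⱼ → ι uⱼ ≡ ι (p ℤ.^ a) ℚ.* x j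
  cleared j = proj₂ (clearEntry p (entries j)) a (proj₂ (upperBound n threshold) j)
  u : Fin n → ℤ
  u j = proj₁ (cleared j)
  scaled : ScaledSolution L (p ℤ.^ a) u
  scaled i = begin
      dot (row L i) (λ j → ι (u j))                  ≡⟨ dot-cong (row L i) (λ j → proj₂ (cleared j)) ⟩
      dot (row L i) (λ j → ι (p ℤ.^ a) ℚ.* x j)      ≡⟨ dot-scale (row L i) x (ι (p ℤ.^ a)) ⟩
      ι (p ℤ.^ a) ℚ.* dot (row L i) x                ≡⟨ cong (ι (p ℤ.^ a) ℚ.*_) (solves i) ⟩
      ι (p ℤ.^ a) ℚ.* ι (rhs L i)                    ≡⟨ ι-* (p ℤ.^ a) (rhs L i) ⟨
      ι (p ℤ.^ a ℤ.* rhs L i)                        ∎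
    where open ≡-Reasoning

Bezout : ℤ → ℤ → Set
Bezout X Y = Σ ℤ λ s → Σ ℤ λ t → s ℤ.* X ℤ.+ t ℤ.* Y ≡ + 1

bezout-sym : ∀ {X Y} → Bezout X Y → Bezout Y X
bezout-sym {X} {Y} (s , t , e) = t , s , trans (ℤP.+-comm (t ℤ.* Y) (s ℤ.* X)) e

-- If X and Y are each coprime to Q, so is X·Y: multiply the two identities.
bezout-*ˡ : ∀ {X Y Q} → Bezout X Q → Bezout Y Q → Bezout (X ℤ.* Y) Q
bezout-*ˡ {X} {Y} {Q} (s₁ , t₁ , e₁) (s₂ , t₂ , e₂) =
  s₁ ℤ.* s₂ , s₁ ℤ.* X ℤ.* t₂ ℤ.+ t₁ ℤ.* s₂ ℤ.* Y ℤ.+ t₁ ℤ.* t₂ ℤ.* Q ,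
  trans (expand s₁ s₂ t₁ t₂ X Y Q) (cong₂ ℤ._*_ e₁ e₂)
  where
  expand : ∀ s₁ s₂ t₁ t₂ X Y Q →
    s₁ ℤ.* s₂ ℤ.* (X ℤ.* Y) ℤ.+ (s₁ ℤ.* X ℤ.* t₂ ℤ.+ t₁ ℤ.* s₂ ℤ.* Y ℤ.+ t₁ ℤ.* t₂ ℤ.* Q) ℤ.* Q
      ≡ (s₁ ℤ.* X ℤ.+ t₁ ℤ.* Q) ℤ.* (s₂ ℤ.* Y ℤ.+ t₂ ℤ.* Q)
  expand = solveℤ

bezout-^ˡ : ∀ {X Q} → Bezout X Q → ∀ a → Bezout (X ℤ.^ a) Q
bezout-^ˡ {Q = Q} _ ℕ.zero = + 1 , + 0 , cong (ℤ._+_ (+ 1)) (ℤP.*-zeroˡ Q)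
bezout-^ˡ b (ℕ.suc a) = bezout-*ˡ b (bezout-^ˡ b a)

bezout-^ : ∀ {X Y} → Bezout X Y → ∀ a b → Bezout (X ℤ.^ a) (Y ℤ.^ b)
bezout-^ bxy a b = bezout-sym (bezout-^ˡ (bezout-sym (bezout-^ˡ bxy a)) b)

-- A Bézout identity for ∣X∣ gives one for X (flip the sign of s if X < 0).
bezout-abs : ∀ {X Y} → Bezout (+ ∣ X ∣) Y → Bezout X Y
bezout-abs {X} {Y} (s , t , e) with ℤP.+∣i∣≡i⊎+∣i∣≡-i X
... | inj₁ ∣X∣≡X  = s , t , subst (λ X′ → s ℤ.* X′ ℤ.+ t ℤ.* Y ≡ + 1) ∣X∣≡X e
... | inj₂ ∣X∣≡-X = ℤ.- s , t , trans (cong (ℤ._+ t ℤ.* Y) flipSign) e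
  where
  flipSign : ℤ.- s ℤ.* X ≡ s ℤ.* + ∣ X ∣
  flipSign = begin
    ℤ.- s ℤ.* X       ≡⟨ ℤP.neg-distribˡ-* s X ⟨
    ℤ.- (s ℤ.* X)     ≡⟨ ℤP.neg-distribʳ-* s X ⟩
    s ℤ.* ℤ.- X       ≡⟨ cong (s ℤ.*_) ∣X∣≡-X ⟨
    s ℤ.* + ∣ X ∣     ∎
    where open ≡-Reasoning

bezout-ℕ : ∀ {m n} x y → 1 ℕ.+ y ℕ.* n ≡ x ℕ.* m → Bezout (+ m) (+ n)
bezout-ℕ {m} {n} x y e = + x , ℤ.- + y , (begin
    + x ℤ.* + m ℤ.+ ℤ.- + y ℤ.* + n                 ≡⟨ cong (ℤ._+ ℤ.- + y ℤ.* + n) (ℤP.pos-* x m) ⟨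
    + (x ℕ.* m) ℤ.+ ℤ.- + y ℤ.* + n                 ≡⟨ cong (λ k → + k ℤ.+ ℤ.- + y ℤ.* + n) e ⟨
    + (1 ℕ.+ y ℕ.* n) ℤ.+ ℤ.- + y ℤ.* + n           ≡⟨ cong (ℤ._+ ℤ.- + y ℤ.* + n) (ℤP.pos-+ 1 (y ℕ.* n)) ⟩
    + 1 ℤ.+ + (y ℕ.* n) ℤ.+ ℤ.- + y ℤ.* + n         ≡⟨ cong (λ k → + 1 ℤ.+ k ℤ.+ ℤ.- + y ℤ.* + n) (ℤP.pos-* y n) ⟩
    + 1 ℤ.+ + y ℤ.* + n ℤ.+ ℤ.- + y ℤ.* + n         ≡⟨ cancel (+ y) (+ n) ⟩
    + 1                                             ∎)
  where
  open ≡-Reasoning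
  cancel : ∀ y n → + 1 ℤ.+ y ℤ.* n ℤ.+ ℤ.- y ℤ.* n ≡ + 1
  cancel = solveℤ

coprime⇒bezout : ∀ {p q} → Coprime ∣ p ∣ ∣ q ∣ → Bezout p q
coprime⇒bezout c with NC.coprime-Bézout c
... | NG.Bézout.+- x y e = bezout-abs (bezout-sym (bezout-abs (bezout-sym (bezout-ℕ x y e))))
... | NG.Bézout.-+ x y e = bezout-abs (bezout-sym (bezout-abs (bezout-ℕ y x e)))

mainTheorem3 : ∀ {m n : ℕ} (L : LinSys m n) (p q : ℤ) →
    Coprime ∣ p ∣ ∣ q ∣ →
    (∃ λ (x : Fin n → _) → IsPSolution p L x) →
    (∃ λ (y : Fin n → _) → IsPSolution q L y) →
    ∃ λ (z : Fin n → ℤ) → IsIntSolution L z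
mainTheorem3 {n = n} L p q coprime (x , px) (y , qy)
  with clearDenominators L p px | clearDenominators L q qy
... | a , u , pᵃ-scaled | b , v , qᵇ-scaled
  with bezout-^ (coprime⇒bezout coprime) a b
... | s , t , sPᵃ+tQᵇ≡1 = z , unscaled L {z} z-is-1-scaled
  where
  z : Fin n → ℤ
  z j = s ℤ.* u j ℤ.+ t ℤ.* v j
  z-is-1-scaled : ScaledSolution L (+ 1) z
  z-is-1-scaled = subst (λ c → ScaledSolution L c z) sPᵃ+tQᵇ≡1
                        (scaled-combination L s t pᵃ-scaled qᵇ-scaled)
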